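{- Let $P\in\mathbb{F}_q[t]$ be irreducible of degree $d$ and let $e$ be a positive integer with $e\le q^d$. Let $e=\sum_{j=0}^{k}i_jq^j$ be the $q$-adic expansion of $e$ ($0\le i_j\le q-1$). Then $$S(P^e)=a_{i_0}t^d+a_{i_1}t^{d+1}+\dots+a_{i_k}t^{d+k}.$$
   Context: Let $\mathbb{F}_q$ be a finite field with $q$ elements ($q$ a prime power). Fix an enumeration $\mathbb{F}_q=\{a_0,a_1,\dots,a_{q-1}\}$ with $a_0=0$, $a_1=1$. Every nonzero $f\in\mathbb{F}_q[t]$ of degree $m$ is uniquely written $f=a_{i_0}+a_{i_1}t+\dots+a_{i_m}t^m$ with $0\le i_j\le q-1$, $a_{i_m}\neq 0$. Put $\delta(f)=i_0+i_1q+\dots+i_mq^m$ and $\delta(0)=0$. Order $\mathbb{F}_q[t]$ by: $f>g$ iff $\delta(f)>\delta(g)$. For nonzero $f$, $f!=\prod_{g<f}(f-g)$ (product over all $g\in\mathbb{F}_q[t]$ with $g<f$), and $0!=1$. For nonzero $f$, $S(f)$ is the smallest $g$ (in this order) with $f\mid g!$; $S(0)=0$. -}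

module Defs where

open import Data.Nat using (ℕ; zero; suc; _<_; _≤_; NonZero) renaming (_+_ to _+ℕ_; _*_ to _*ℕ_)
open import Data.Nat.DivMod using (_/_; _%_; m%n<n)
open import Data.Fin using (Fin; toℕ; fromℕ<) renaming (_≟_ to _≟F_)
open import Data.List using (List; []; _∷_; foldr; map; upTo; length)
open import Data.Product using (Σ; _×_)
open import Data.Sum using (_⊎_)
open import Relation.Nullary using (¬_; yes; no)
open import Relation.Binary.PropositionalEquality using (_≡_)
open import Algebra.Structures using (IsCommutativeRing)

-- A finite field F_q together with an enumeration {a_0,…,a_{q-1}}:
-- the carrier is Fin q and the element with index i is a_i.
record EnumField (q : ℕ) : Set where
  field
    _+_ _*_ : Fin q → Fin q → Fin q
    -_ : Fin q → Fin q
    0# 1# : Fin q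
    isCommutativeRing : IsCommutativeRing _≡_ _+_ _*_ -_ 0# 1#
    0≢1 : ¬ (0# ≡ 1#)
    inverse : ∀ x → ¬ (x ≡ 0#) → Σ (Fin q) (λ y → x * y ≡ 1#)
    zero-idx : toℕ 0# ≡ 0
    one-idx : toℕ 1# ≡ 1

-- Polynomials in F_q[t]: little-endian coefficient lists
-- (c₀ ∷ c₁ ∷ … represents c₀ + c₁ t + …); trailing zeros allowed,
-- equality of polynomials is _≈P_ (equality after stripping trailing zeros).
Poly : ℕ → Set
Poly q = List (Fin q)

module PolyOps {q : ℕ} {{_ : NonZero q}} (F : EnumField q) where
  open EnumField F

  _+P_ : Poly q → Poly q → Poly q
  [] +P g = g
  (a ∷ f) +P [] = a ∷ f
  (a ∷ f) +P (b ∷ g) = (a + b) ∷ (f +P g)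

  -P_ : Poly q → Poly q
  -P f = map -_ f

  _-P_ : Poly q → Poly q → Poly q
  f -P g = f +P (-P g)

  scale : Fin q → Poly q → Poly q
  scale a g = map (a *_) g

  _*P_ : Poly q → Poly q → Poly q
  [] *P g = []
  (a ∷ f) *P g = scale a g +P (0# ∷ (f *P g))

  oneP : Poly q
  oneP = 1# ∷ []

  _^P_ : Poly q → ℕ → Poly q
  f ^P zero = oneP
  f ^P suc n = f *P (f ^P n)

  norm : Poly q → Poly q
  norm [] = []
  norm (a ∷ f) with norm f
  ... | b ∷ g = a ∷ b ∷ g
  ... | [] with a ≟F 0#
  ...   | yes _ = []
  ...   | no _ = a ∷ []

  _≈P_ : Poly q → Poly q → Set
  f ≈P g = norm f ≡ norm g

  HasDegree : Poly q → ℕ → Set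
  HasDegree f d = length (norm f) ≡ suc d

  IsConstant : Poly q → Set
  IsConstant f = length (norm f) ≤ 1

  _∣P_ : Poly q → Poly q → Set
  f ∣P g = Σ (Poly q) (λ h → (f *P h) ≈P g)

  Irreducible : Poly q → Set
  Irreducible P = ¬ IsConstant P
                × (∀ a b → (a *P b) ≈P P → IsConstant a ⊎ IsConstant b)

  δ : Poly q → ℕ
  δ [] = 0
  δ (c ∷ f) = toℕ c +ℕ q *ℕ δ f

  -- q-adic digits of n (little-endian), read as the polynomial with δ = n
  digitsFuel : ℕ → ℕ → Poly q
  digitsFuel zero n = []
  digitsFuel (suc k) zero = []
  digitsFuel (suc k) (suc n) = fromℕ< (m%n<n (suc n) q) ∷ digitsFuel k (suc n / q)

  digits : ℕ → Poly q
  digits n = digitsFuel n n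

  -- f! = ∏_{g < f} (f - g); the g with g < f are exactly digits n for n < δ f.
  _! : Poly q → Poly q
  f ! = foldr _*P_ oneP (map (λ n → f -P digits n) (upTo (δ f)))

  IsS : Poly q → Poly q → Set
  IsS f g = (f ∣P (g !)) × (∀ h → δ h < δ g → ¬ (f ∣P (h !)))

-- Order F_q[t] by δ and put Q = q^d. Since δ reads coefficients as base-q digits, the polynomials
-- g with δ g < Q are exactly those of degree < d, which form a set of representatives of
-- F_q[t]/(P); and writing k = Q j + r with r < Q, the k-th polynomial is t^d·(j-th) + (r-th).
-- Hence, among the factors f - g of f! with δ g in a block [Q j, Q j + Q), exactly one is divisible
-- by P. For T = t^d·(e-th polynomial) we have δ T = Q e, so T! contains e full blocks and P^e ∣ T!.
-- If δ h = Q m + r < Q e, then h! consists of m full blocks and a partial one; the partial block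
-- contributes no factor of P, and since e ≤ Q every factor of h! has degree < 2d, so each full block
-- contributes exactly one factor P. As P is prime, P^m exactly divides h! and m < e.
module Submission where

open import Defs
open import Level using (0ℓ)
open import Data.Nat using (ℕ; zero; suc; NonZero; _≤_; _<_; _≤?_; z≤n; s≤s; _^_)
  renaming (_+_ to _+ℕ_; _*_ to _*ℕ_)
import Data.Nat.Properties as ℕ
open import Data.Nat.DivMod using (_/_; _%_; m%n<n; m≡m%n+[m/n]*n; [m+kn]%n≡m%n; m<n⇒m%n≡m; m/n<m; m<n*o⇒m/o<n)
open import Data.Nat.Solver using (module +-*-Solver)
open import Function using (_∘_)
open import Data.Fin using (Fin; toℕ; fromℕ<) renaming (_≟_ to _≟F_)
open import Data.Fin.Properties using (toℕ-injective; toℕ<n; toℕ-fromℕ<)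
open import Data.List using ([]; _∷_; length; replicate; _++_; foldr; map; applyUpTo)
open import Data.Maybe using (nothing)
open import Data.Product using (Σ; _×_; _,_; proj₁; proj₂)
open import Data.Sum using (_⊎_; inj₁; inj₂)
open import Data.Empty using (⊥-elim)
open import Relation.Nullary using (¬_; Dec; yes; no)
open import Relation.Binary.PropositionalEquality
open import Algebra.Bundles using (CommutativeRing)
import Algebra.Properties.Ring as RingProperties
import Algebra.Properties.AbelianGroup as AbelianGroupProperties
import Relation.Binary.Reasoning.Setoid as SetoidReasoning
open import Tactic.RingSolver.Core.AlmostCommutativeRing using (fromCommutativeRing)
import Tactic.RingSolver.NonReflective as RingSolver

map-applyUpTo : ∀ {A B : Set} (g : A → B) (h : ℕ → A) n → map g (applyUpTo h n) ≡ applyUpTo (λ k → g (h k)) n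
map-applyUpTo g h zero    = refl
map-applyUpTo g h (suc n) = cong (g (h 0) ∷_) (map-applyUpTo g (λ k → h (suc k)) n)

module PolynomialsOver {q : ℕ} {{_ : NonZero q}} (F : EnumField q) where
  open PolyOps F

  coeffRing : CommutativeRing 0ℓ 0ℓ
  coeffRing = record { isCommutativeRing = EnumField.isCommutativeRing F }

  module K = CommutativeRing coeffRing
  open K using (_+_; _*_; -_; 0#; 1#)
  open RingProperties K.ring using (-0#≈0#)
  module K-Solver = RingSolver (fromCommutativeRing coeffRing (λ _ → nothing))

  -- Polynomial arithmetic up to equality of coefficients

  coeff : Poly q → ℕ → Fin q
  coeff []      n       = 0#
  coeff (a ∷ f) zero    = a
  coeff (a ∷ f) (suc n) = coeff f n

  infix 4 _≋_
  record _≋_ (f g : Poly q) : Set where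
    constructor mk≋
    field coeff-≡ : ∀ n → coeff f n ≡ coeff g n
  open _≋_ public

  ≋-refl : ∀ {f} → f ≋ f
  ≋-refl = mk≋ λ _ → refl

  ≋-reflexive : ∀ {f g} → f ≡ g → f ≋ g
  ≋-reflexive refl = ≋-refl

  ≋-sym : ∀ {f g} → f ≋ g → g ≋ f
  ≋-sym f≋g = mk≋ λ n → sym (coeff-≡ f≋g n)

  ≋-trans : ∀ {f g h} → f ≋ g → g ≋ h → f ≋ h
  ≋-trans f≋g g≋h = mk≋ λ n → trans (coeff-≡ f≋g n) (coeff-≡ g≋h n)

  ∷-cong : ∀ {a b f g} → a ≡ b → f ≋ g → a ∷ f ≋ b ∷ g
  ∷-cong a≡b f≋g = mk≋ λ { zero → a≡b ; (suc n) → coeff-≡ f≋g n }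

  tail-≋ : ∀ {a b f g} → a ∷ f ≋ b ∷ g → f ≋ g
  tail-≋ af≋bg = mk≋ λ n → coeff-≡ af≋bg (suc n)

  coeff-+P : ∀ f g n → coeff (f +P g) n ≡ coeff f n + coeff g n
  coeff-+P []      g       n       = sym (K.+-identityˡ _)
  coeff-+P (a ∷ f) []      n       = sym (K.+-identityʳ _)
  coeff-+P (a ∷ f) (b ∷ g) zero    = refl
  coeff-+P (a ∷ f) (b ∷ g) (suc n) = coeff-+P f g n

  coeff-scale : ∀ a g n → coeff (scale a g) n ≡ a * coeff g n
  coeff-scale a []      n       = sym (K.zeroʳ a)
  coeff-scale a (b ∷ g) zero    = refl
  coeff-scale a (b ∷ g) (suc n) = coeff-scale a g n

  coeff--P : ∀ f n → coeff (-P f) n ≡ - coeff f n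
  coeff--P []      n       = sym -0#≈0#
  coeff--P (a ∷ f) zero    = refl
  coeff--P (a ∷ f) (suc n) = coeff--P f n

  coeff-*P-∷ : ∀ a f g n → coeff ((a ∷ f) *P g) n ≡ a * coeff g n + coeff (0# ∷ (f *P g)) n
  coeff-*P-∷ a f g n = trans (coeff-+P (scale a g) _ n) (cong (_+ _) (coeff-scale a g n))

  coeff-0∷-zero : ∀ f → [] ≋ f → ∀ n → coeff (0# ∷ f) n ≡ 0#
  coeff-0∷-zero f f≋0 zero    = refl
  coeff-0∷-zero f f≋0 (suc n) = sym (coeff-≡ f≋0 n)

  +P-cong : ∀ {f f′ g g′} → f ≋ f′ → g ≋ g′ → f +P g ≋ f′ +P g′
  +P-cong {f} {f′} {g} {g′} f≋f′ g≋g′ = mk≋ λ n →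
    trans (coeff-+P f g n) (trans (cong₂ _+_ (coeff-≡ f≋f′ n) (coeff-≡ g≋g′ n)) (sym (coeff-+P f′ g′ n)))

  -P-cong : ∀ {f f′} → f ≋ f′ → -P f ≋ -P f′
  -P-cong {f} {f′} f≋f′ = mk≋ λ n →
    trans (coeff--P f n) (trans (cong -_ (coeff-≡ f≋f′ n)) (sym (coeff--P f′ n)))

  zero-*P : ∀ f g → [] ≋ f → [] ≋ f *P g
  zero-*P []      g f≋0 = ≋-refl
  zero-*P (b ∷ f) g f≋0 = mk≋ λ n → sym (trans (coeff-*P-∷ b f g n) (vanish n))
    where
    b≡0 : b ≡ 0#
    b≡0 = sym (coeff-≡ f≋0 0)
    vanish : ∀ n → b * coeff g n + coeff (0# ∷ (f *P g)) n ≡ 0#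
    vanish n = trans (cong₂ _+_ (trans (cong (_* _) b≡0) (K.zeroˡ _)) (coeff-0∷-zero (f *P g) (zero-*P f g (mk≋ λ k → coeff-≡ f≋0 (suc k))) n))
                     (K.+-identityʳ 0#)

  *P-congʳ : ∀ {f f′} g → f ≋ f′ → f *P g ≋ f′ *P g
  *P-congʳ {[]}    {f′}     g f≋f′ = zero-*P f′ g f≋f′
  *P-congʳ {a ∷ f} {[]}     g f≋f′ = ≋-sym (zero-*P (a ∷ f) g (≋-sym f≋f′))
  *P-congʳ {a ∷ f} {b ∷ f′} g f≋f′ = mk≋ λ n →
    trans (coeff-*P-∷ a f g n)
      (trans (cong₂ _+_ (cong (_* _) (coeff-≡ f≋f′ 0)) (coeff-≡ (∷-cong refl (*P-congʳ g (tail-≋ f≋f′))) n))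
        (sym (coeff-*P-∷ b f′ g n)))

  *P-congˡ : ∀ f {g g′} → g ≋ g′ → f *P g ≋ f *P g′
  *P-congˡ []      g≋g′ = ≋-refl
  *P-congˡ (a ∷ f) {g} {g′} g≋g′ = mk≋ λ n →
    trans (coeff-*P-∷ a f g n)
      (trans (cong₂ _+_ (cong (a *_) (coeff-≡ g≋g′ n)) (coeff-≡ (∷-cong refl (*P-congˡ f g≋g′)) n))
        (sym (coeff-*P-∷ a f g′ n)))

  *P-cong : ∀ {f f′ g g′} → f ≋ f′ → g ≋ g′ → f *P g ≋ f′ *P g′
  *P-cong {f′ = f′} {g} f≋f′ g≋g′ = ≋-trans (*P-congʳ g f≋f′) (*P-congˡ f′ g≋g′)

  +P-assoc : ∀ f g h → (f +P g) +P h ≋ f +P (g +P h)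
  +P-assoc f g h = mk≋ λ n → begin
    coeff ((f +P g) +P h) n           ≡⟨ coeff-+P (f +P g) h n ⟩
    coeff (f +P g) n + coeff h n      ≡⟨ cong (_+ _) (coeff-+P f g n) ⟩
    (coeff f n + coeff g n) + coeff h n ≡⟨ K.+-assoc _ _ _ ⟩
    coeff f n + (coeff g n + coeff h n) ≡⟨ cong (_ +_) (coeff-+P g h n) ⟨
    coeff f n + coeff (g +P h) n      ≡⟨ coeff-+P f (g +P h) n ⟨
    coeff (f +P (g +P h)) n           ∎
    where open ≡-Reasoning

  +P-comm : ∀ f g → f +P g ≋ g +P f
  +P-comm f g = mk≋ λ n → trans (coeff-+P f g n) (trans (K.+-comm _ _) (sym (coeff-+P g f n)))

  +P-identityʳ : ∀ f → f +P [] ≋ f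
  +P-identityʳ f = mk≋ λ n → trans (coeff-+P f [] n) (K.+-identityʳ _)

  -P-inverseʳ : ∀ f → f +P (-P f) ≋ []
  -P-inverseʳ f = mk≋ λ n →
    trans (coeff-+P f (-P f) n) (trans (cong (coeff f n +_) (coeff--P f n)) (K.-‿inverseʳ _))

  *P-identityˡ : ∀ f → oneP *P f ≋ f
  *P-identityˡ f = mk≋ λ n →
    trans (coeff-*P-∷ 1# [] f n) (trans (cong₂ _+_ (K.*-identityˡ _) (coeff-0∷-zero [] ≋-refl n)) (K.+-identityʳ _))

  *P-zeroʳ : ∀ f → f *P [] ≋ []
  *P-zeroʳ []      = ≋-refl
  *P-zeroʳ (a ∷ f) = mk≋ λ n →
    trans (coeff-*P-∷ a f [] n)
      (trans (cong₂ _+_ (K.zeroʳ a) (coeff-0∷-zero (f *P []) (≋-sym (*P-zeroʳ f)) n)) (K.+-identityʳ 0#))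

  coeff-0∷-+P : ∀ f g n → coeff (0# ∷ (f +P g)) n ≡ coeff (0# ∷ f) n + coeff (0# ∷ g) n
  coeff-0∷-+P f g zero    = sym (K.+-identityʳ 0#)
  coeff-0∷-+P f g (suc n) = coeff-+P f g n

  *P-distribʳ : ∀ h f g → (f +P g) *P h ≋ (f *P h) +P (g *P h)
  *P-distribʳ h []      g       = ≋-refl
  *P-distribʳ h (a ∷ f) []      = ≋-sym (+P-identityʳ _)
  *P-distribʳ h (a ∷ f) (b ∷ g) = mk≋ λ n → begin
    coeff (((a ∷ f) +P (b ∷ g)) *P h) n
      ≡⟨ coeff-*P-∷ (a + b) (f +P g) h n ⟩
    (a + b) * coeff h n + coeff (0# ∷ ((f +P g) *P h)) n
      ≡⟨ cong ((a + b) * coeff h n +_) (trans (coeff-≡ (∷-cong refl (*P-distribʳ h f g)) n) (coeff-0∷-+P (f *P h) (g *P h) n)) ⟩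
    (a + b) * coeff h n + (coeff (0# ∷ (f *P h)) n + coeff (0# ∷ (g *P h)) n)
      ≡⟨ regroup (coeff h n) a b _ _ ⟩
    (a * coeff h n + coeff (0# ∷ (f *P h)) n) + (b * coeff h n + coeff (0# ∷ (g *P h)) n)
      ≡⟨ cong₂ _+_ (coeff-*P-∷ a f h n) (coeff-*P-∷ b g h n) ⟨
    coeff ((a ∷ f) *P h) n + coeff ((b ∷ g) *P h) n
      ≡⟨ coeff-+P ((a ∷ f) *P h) ((b ∷ g) *P h) n ⟨
    coeff (((a ∷ f) *P h) +P ((b ∷ g) *P h)) n ∎
    where
    open ≡-Reasoning
    open K-Solver
    regroup : ∀ x a b y z → (a + b) * x + (y + z) ≡ (a * x + y) + (b * x + z)
    regroup = solve 5 (λ x a b y z → ((a ⊕ b) ⊗ x ⊕ (y ⊕ z)) ⊜ ((a ⊗ x ⊕ y) ⊕ (b ⊗ x ⊕ z))) refl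

  *P-∷ʳ : ∀ f b g → f *P (b ∷ g) ≋ scale b f +P (0# ∷ (f *P g))
  *P-∷ʳ []      b g = mk≋ λ { zero → refl ; (suc n) → refl }
  *P-∷ʳ (a ∷ f) b g = mk≋ λ
    { zero → trans (coeff-*P-∷ a f (b ∷ g) 0)
               (trans (cong (_+ _) (K.*-comm a b)) (sym (coeff-+P (scale b (a ∷ f)) (0# ∷ ((a ∷ f) *P g)) 0)))
    ; (suc n) → begin
      coeff ((a ∷ f) *P (b ∷ g)) (suc n)
        ≡⟨ coeff-*P-∷ a f (b ∷ g) (suc n) ⟩
      a * coeff g n + coeff (f *P (b ∷ g)) n
        ≡⟨ cong (a * coeff g n +_) (trans (coeff-≡ (*P-∷ʳ f b g) n) (trans (coeff-+P (scale b f) _ n) (cong (_+ _) (coeff-scale b f n)))) ⟩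
      a * coeff g n + (b * coeff f n + coeff (0# ∷ (f *P g)) n)
        ≡⟨ exchange (coeff g n) a b (coeff f n) (coeff (0# ∷ (f *P g)) n) ⟩
      b * coeff f n + (a * coeff g n + coeff (0# ∷ (f *P g)) n)
        ≡⟨ cong₂ _+_ (coeff-scale b f n) (coeff-*P-∷ a f g n) ⟨
      coeff (scale b f) n + coeff ((a ∷ f) *P g) n
        ≡⟨ coeff-+P (scale b (a ∷ f)) (0# ∷ ((a ∷ f) *P g)) (suc n) ⟨
      coeff (scale b (a ∷ f) +P (0# ∷ ((a ∷ f) *P g))) (suc n) ∎ }
    where
    open ≡-Reasoning
    open K-Solver
    exchange : ∀ x a b y z → a * x + (b * y + z) ≡ b * y + (a * x + z)
    exchange = solve 5 (λ x a b y z → (a ⊗ x ⊕ (b ⊗ y ⊕ z)) ⊜ (b ⊗ y ⊕ (a ⊗ x ⊕ z))) refl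

  *P-comm : ∀ f g → f *P g ≋ g *P f
  *P-comm []      g = ≋-sym (*P-zeroʳ g)
  *P-comm (a ∷ f) g = ≋-trans (+P-cong ≋-refl (∷-cong refl (*P-comm f g))) (≋-sym (*P-∷ʳ g a f))

  scale-*P : ∀ a g h → scale a g *P h ≋ scale a (g *P h)
  scale-*P a []      h = mk≋ λ n → sym (trans (coeff-scale a [] n) (K.zeroʳ a))
  scale-*P a (b ∷ g) h = mk≋ λ n → begin
    coeff ((a * b ∷ scale a g) *P h) n
      ≡⟨ coeff-*P-∷ (a * b) (scale a g) h n ⟩
    a * b * coeff h n + coeff (0# ∷ (scale a g *P h)) n
      ≡⟨ cong (a * b * coeff h n +_) (shifted n) ⟩
    a * b * coeff h n + a * coeff (0# ∷ (g *P h)) n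
      ≡⟨ factor (coeff h n) a b _ ⟩
    a * (b * coeff h n + coeff (0# ∷ (g *P h)) n)
      ≡⟨ cong (a *_) (coeff-*P-∷ b g h n) ⟨
    a * coeff ((b ∷ g) *P h) n
      ≡⟨ coeff-scale a ((b ∷ g) *P h) n ⟨
    coeff (scale a ((b ∷ g) *P h)) n ∎
    where
    open ≡-Reasoning
    open K-Solver
    shifted : ∀ n → coeff (0# ∷ (scale a g *P h)) n ≡ a * coeff (0# ∷ (g *P h)) n
    shifted zero    = sym (K.zeroʳ a)
    shifted (suc n) = trans (coeff-≡ (scale-*P a g h) n) (coeff-scale a (g *P h) n)
    factor : ∀ x a b y → a * b * x + a * y ≡ a * (b * x + y)
    factor = solve 4 (λ x a b y → (a ⊗ b ⊗ x ⊕ a ⊗ y) ⊜ (a ⊗ (b ⊗ x ⊕ y))) refl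

  0∷-*P : ∀ f h → (0# ∷ f) *P h ≋ 0# ∷ (f *P h)
  0∷-*P f h = mk≋ λ n →
    trans (coeff-*P-∷ 0# f h n) (trans (cong (_+ coeff (0# ∷ (f *P h)) n) (K.zeroˡ _)) (K.+-identityˡ _))

  *P-assoc : ∀ f g h → (f *P g) *P h ≋ f *P (g *P h)
  *P-assoc []      g h = ≋-refl
  *P-assoc (a ∷ f) g h =
    ≋-trans (*P-distribʳ h (scale a g) (0# ∷ (f *P g)))
      (+P-cong (scale-*P a g h) (≋-trans (0∷-*P (f *P g) h) (∷-cong refl (*P-assoc f g h))))

  *P-rotate : ∀ x a z → (x *P a) *P z ≋ (x *P z) *P a
  *P-rotate x a z = ≋-trans (*P-assoc x a z) (≋-trans (*P-congˡ x (*P-comm a z)) (≋-sym (*P-assoc x z a)))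

  polyRing : CommutativeRing 0ℓ 0ℓ
  polyRing = record
    { Carrier = Poly q ; _≈_ = _≋_ ; _+_ = _+P_ ; _*_ = _*P_ ; -_ = -P_ ; 0# = [] ; 1# = oneP
    ; isCommutativeRing = record
      { isRing = record
        { +-isAbelianGroup = record
          { isGroup = record
            { isMonoid = record
              { isSemigroup = record
                { isMagma = record
                  { isEquivalence = record { refl = ≋-refl ; sym = ≋-sym ; trans = ≋-trans }
                  ; ∙-cong = +P-cong }
                ; assoc = +P-assoc }
              ; identity = (λ _ → ≋-refl) , +P-identityʳ }
            ; inverse = (λ f → ≋-trans (+P-comm (-P f) f) (-P-inverseʳ f)) , -P-inverseʳ
            ; ⁻¹-cong = -P-cong }
          ; comm = +P-comm }
        ; *-cong = *P-cong
        ; *-assoc = *P-assoc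
        ; *-identity = *P-identityˡ , (λ f → ≋-trans (*P-comm f oneP) (*P-identityˡ f))
        ; distrib = (λ h f g → ≋-trans (*P-comm h (f +P g)) (≋-trans (*P-distribʳ h f g) (+P-cong (*P-comm f h) (*P-comm g h))))
                  , *P-distribʳ }
      ; *-comm = *P-comm } }

  module R = CommutativeRing polyRing
  module R-Solver = RingSolver (fromCommutativeRing polyRing (λ _ → nothing))
  open RingProperties R.ring using (-‿distribˡ-*; x[y-z]≈xy-xz)
  open AbelianGroupProperties R.+-abelianGroup using (⁻¹-∙-comm; xyx⁻¹≈y; x∙y⁻¹≈ε⇒x≈y)

  -- Degrees and division with remainder

  consNorm : Fin q → Poly q → Poly q
  consNorm a (b ∷ g) = a ∷ b ∷ g
  consNorm a [] with a ≟F 0#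
  ... | yes _ = []
  ... | no _  = a ∷ []

  norm-∷ : ∀ a f → norm (a ∷ f) ≡ consNorm a (norm f)
  norm-∷ a f with norm f
  ... | b ∷ g = refl
  ... | [] with a ≟F 0#
  ...   | yes _ = refl
  ...   | no _  = refl

  consNorm-≋ : ∀ a g → consNorm a g ≋ a ∷ g
  consNorm-≋ a (b ∷ g) = ≋-refl
  consNorm-≋ a [] with a ≟F 0#
  ... | yes a≡0 = mk≋ λ { zero → sym a≡0 ; (suc n) → refl }
  ... | no _    = ≋-refl

  norm-≋ : ∀ f → norm f ≋ f
  norm-≋ []      = ≋-refl
  norm-≋ (a ∷ f) = ≋-trans (≋-reflexive (norm-∷ a f)) (≋-trans (consNorm-≋ a (norm f)) (∷-cong refl (norm-≋ f)))

  ≈P⇒≋ : ∀ {f g} → f ≈P g → f ≋ g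
  ≈P⇒≋ {f} {g} f≈g = ≋-trans (≋-sym (norm-≋ f)) (≋-trans (≋-reflexive f≈g) (norm-≋ g))

  consNorm-0# : consNorm 0# [] ≡ []
  consNorm-0# with 0# ≟F 0#
  ... | yes _   = refl
  ... | no 0≢0 = ⊥-elim (0≢0 refl)

  norm-zero : ∀ f → [] ≋ f → norm f ≡ []
  norm-zero []      f≋0 = refl
  norm-zero (a ∷ f) f≋0 = begin
    norm (a ∷ f)          ≡⟨ norm-∷ a f ⟩
    consNorm a (norm f)   ≡⟨ cong₂ consNorm (sym (coeff-≡ f≋0 0)) (norm-zero f (mk≋ λ n → coeff-≡ f≋0 (suc n))) ⟩
    consNorm 0# []        ≡⟨ consNorm-0# ⟩
    []                    ∎
    where open ≡-Reasoning

  ≋⇒≈P : ∀ {f g} → f ≋ g → f ≈P g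
  ≋⇒≈P {[]}    {g}     f≋g = sym (norm-zero g f≋g)
  ≋⇒≈P {a ∷ f} {[]}    f≋g = norm-zero (a ∷ f) (≋-sym f≋g)
  ≋⇒≈P {a ∷ f} {b ∷ g} f≋g =
    trans (norm-∷ a f) (trans (cong₂ consNorm (coeff-≡ f≋g 0) (≋⇒≈P (tail-≋ f≋g))) (sym (norm-∷ b g)))

  DegreeBelow : ℕ → Poly q → Set
  DegreeBelow n f = ∀ k → n ≤ k → coeff f k ≡ 0#

  Degree : ℕ → Poly q → Set
  Degree d f = DegreeBelow (suc d) f × ¬ coeff f d ≡ 0#

  DegreeBelow-cong : ∀ {n f g} → f ≋ g → DegreeBelow n f → DegreeBelow n g
  DegreeBelow-cong f≋g f<n k n≤k = trans (sym (coeff-≡ f≋g k)) (f<n k n≤k)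

  DegreeBelow-mono : ∀ {m n f} → m ≤ n → DegreeBelow m f → DegreeBelow n f
  DegreeBelow-mono m≤n f<m k n≤k = f<m k (ℕ.≤-trans m≤n n≤k)

  DegreeBelow-∷ : ∀ {n a f} → DegreeBelow (suc n) (a ∷ f) → DegreeBelow n f
  DegreeBelow-∷ af<n k n≤k = af<n (suc k) (s≤s n≤k)

  DegreeBelow-zero : ∀ f → DegreeBelow 0 f → [] ≋ f
  DegreeBelow-zero f f<0 = mk≋ λ n → sym (f<0 n z≤n)

  zero-DegreeBelow : ∀ {n} f → [] ≋ f → DegreeBelow n f
  zero-DegreeBelow f f≋0 k _ = sym (coeff-≡ f≋0 k)

  DegreeBelow-length : ∀ f → DegreeBelow (length f) f
  DegreeBelow-length []      k       _         = refl
  DegreeBelow-length (a ∷ f) (suc k) (s≤s n≤k) = DegreeBelow-length f k n≤k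

  consNorm-leading : ∀ a g f m → (∀ m → length g ≡ suc m → ¬ coeff f m ≡ 0#)
                   → length (consNorm a g) ≡ suc m → ¬ coeff (a ∷ f) m ≡ 0#
  consNorm-leading a (b ∷ g) f zero    f-leading ()
  consNorm-leading a (b ∷ g) f (suc m) f-leading len = f-leading m (ℕ.suc-injective len)
  consNorm-leading a []      f m       f-leading len with a ≟F 0#
  consNorm-leading a []      f m       f-leading () | yes _
  consNorm-leading a []      f zero    f-leading _  | no a≢0 = a≢0
  consNorm-leading a []      f (suc m) f-leading () | no _

  length-norm-leading : ∀ f m → length (norm f) ≡ suc m → ¬ coeff f m ≡ 0#
  length-norm-leading []      m ()
  length-norm-leading (a ∷ f) m len =
    consNorm-leading a (norm f) f m (length-norm-leading f) (subst (λ g → length g ≡ suc m) (norm-∷ a f) len)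

  length-norm≤⇒DegreeBelow : ∀ {n} f → length (norm f) ≤ n → DegreeBelow n f
  length-norm≤⇒DegreeBelow f len≤n =
    DegreeBelow-cong (norm-≋ f) (DegreeBelow-mono {f = norm f} len≤n (DegreeBelow-length (norm f)))

  DegreeBelow⇒length-norm≤ : ∀ {n} f → DegreeBelow n f → length (norm f) ≤ n
  DegreeBelow⇒length-norm≤ {n} f f<n with length (norm f) in len
  ... | zero  = z≤n
  ... | suc m with suc m ≤? n
  ...   | yes m<n = m<n
  ...   | no m≮n  = ⊥-elim (length-norm-leading f m len (f<n m (ℕ.≤-pred (ℕ.≰⇒> m≮n))))

  HasDegree⇒Degree : ∀ f d → HasDegree f d → Degree d f
  HasDegree⇒Degree f d len = length-norm≤⇒DegreeBelow f (ℕ.≤-reflexive len) , length-norm-leading f d len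

  DegreeBelow-+P : ∀ {n} f g → DegreeBelow n f → DegreeBelow n g → DegreeBelow n (f +P g)
  DegreeBelow-+P f g f<n g<n k n≤k =
    trans (coeff-+P f g k) (trans (cong₂ _+_ (f<n k n≤k) (g<n k n≤k)) (K.+-identityʳ 0#))

  DegreeBelow--P : ∀ {n} f → DegreeBelow n f → DegreeBelow n (-P f)
  DegreeBelow--P f f<n k n≤k = trans (coeff--P f k) (trans (cong -_ (f<n k n≤k)) -0#≈0#)

  DegreeBelow-*P : ∀ {m n} f g → DegreeBelow (suc m) f → DegreeBelow n g → DegreeBelow (m +ℕ n) (f *P g)
  DegreeBelow-*P         []      g f≤m g<n k _     = refl
  DegreeBelow-*P {m} {n} (a ∷ f) g f≤m g<n k m+n≤k =
    trans (coeff-*P-∷ a f g k) (trans (cong₂ _+_ head (shifted m k f≤m m+n≤k)) (K.+-identityʳ 0#))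
    where
    head : a * coeff g k ≡ 0#
    head = trans (cong (a *_) (g<n k (ℕ.≤-trans (ℕ.m≤n+m n m) m+n≤k))) (K.zeroʳ a)
    shifted : ∀ m k → DegreeBelow (suc m) (a ∷ f) → m +ℕ n ≤ k → coeff (0# ∷ (f *P g)) k ≡ 0#
    shifted m       zero    _   _           = refl
    shifted zero    (suc k) f≤0 _           = sym (coeff-≡ (zero-*P f g (DegreeBelow-zero f (DegreeBelow-∷ f≤0))) k)
    shifted (suc m) (suc k) f≤m (s≤s m+n≤k) = DegreeBelow-*P f g (DegreeBelow-∷ f≤m) g<n k m+n≤k

  coeff-*P-top : ∀ d e f g → DegreeBelow (suc d) f → DegreeBelow (suc e) g
               → coeff (f *P g) (d +ℕ e) ≡ coeff f d * coeff g e
  coeff-*P-top d       e []      g f≤d g≤e = sym (K.zeroˡ _)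
  coeff-*P-top zero    e (a ∷ f) g f≤0 g≤e =
    trans (coeff-*P-∷ a f g e)
      (trans (cong (a * coeff g e +_) (coeff-0∷-zero (f *P g) (zero-*P f g (DegreeBelow-zero f (DegreeBelow-∷ f≤0))) e))
        (K.+-identityʳ _))
  coeff-*P-top (suc d) e (a ∷ f) g f≤d g≤e =
    trans (coeff-*P-∷ a f g (suc (d +ℕ e)))
      (trans (cong₂ _+_ (trans (cong (a *_) (g≤e _ (s≤s (ℕ.m≤n+m e d)))) (K.zeroʳ a))
                        (coeff-*P-top d e f g (DegreeBelow-∷ f≤d) g≤e))
        (K.+-identityˡ _))

  *-nonzero : ∀ {x y} → ¬ x ≡ 0# → ¬ y ≡ 0# → ¬ x * y ≡ 0#
  *-nonzero {x} {y} x≢0 y≢0 xy≡0 with EnumField.inverse F x x≢0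
  ... | x⁻¹ , xx⁻¹≡1 = y≢0 (begin
    y               ≡⟨ K.*-identityˡ y ⟨
    1# * y          ≡⟨ cong (_* y) (trans (sym xx⁻¹≡1) (K.*-comm x x⁻¹)) ⟩
    (x⁻¹ * x) * y   ≡⟨ K.*-assoc x⁻¹ x y ⟩
    x⁻¹ * (x * y)   ≡⟨ cong (x⁻¹ *_) xy≡0 ⟩
    x⁻¹ * 0#        ≡⟨ K.zeroʳ x⁻¹ ⟩
    0#              ∎)
    where open ≡-Reasoning

  Degree-*P : ∀ {d e f g} → Degree d f → Degree e g → Degree (d +ℕ e) (f *P g)
  Degree-*P {d} {e} {f} {g} (f≤d , fd≢0) (g≤e , ge≢0) =
    subst (λ n → DegreeBelow n (f *P g)) (ℕ.+-suc d e) (DegreeBelow-*P f g f≤d g≤e) ,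
    λ top≡0 → *-nonzero fd≢0 ge≢0 (trans (sym (coeff-*P-top d e f g f≤d g≤e)) top≡0)

  zero? : ∀ f → Dec ([] ≋ f)
  zero? f with norm f in eq
  ... | []    = yes (≈P⇒≋ (sym eq))
  ... | a ∷ g = no λ f≋0 → []≢∷ (trans (≋⇒≈P f≋0) eq)
    where
    []≢∷ : ¬ [] ≡ a ∷ g
    []≢∷ ()

  DegreeBelow⇒Degree : ∀ n f → DegreeBelow n f → ¬ [] ≋ f → Σ ℕ λ d → Degree d f
  DegreeBelow⇒Degree zero    f f<0 f≢0 = ⊥-elim (f≢0 (DegreeBelow-zero f f<0))
  DegreeBelow⇒Degree (suc n) f f≤n f≢0 with coeff f n ≟F 0#
  ... | no fn≢0 = n , f≤n , fn≢0
  ... | yes fn≡0 = DegreeBelow⇒Degree n f f<n f≢0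
    where
    f<n : DegreeBelow n f
    f<n k n≤k with ℕ.m≤n⇒m<n∨m≡n n≤k
    ... | inj₁ n<k  = f≤n k n<k
    ... | inj₂ refl = fn≡0

  nonzero⇒Degree : ∀ f → ¬ [] ≋ f → Σ ℕ λ d → Degree d f
  nonzero⇒Degree f = DegreeBelow⇒Degree (length f) f (DegreeBelow-length f)

  Degree⇒nonzero : ∀ {d f} → Degree d f → ¬ [] ≋ f
  Degree⇒nonzero {d} (_ , fd≢0) f≋0 = fd≢0 (sym (coeff-≡ f≋0 d))

  multiple-of-lower-degree⇒zero : ∀ {d} D {w x} → Degree d D → D *P w ≋ x → DegreeBelow d x → [] ≋ w
  multiple-of-lower-degree⇒zero {d} D {w} D=d Dw≋x x<d with zero? w
  ... | yes w≋0 = w≋0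
  ... | no w≢0 with nonzero⇒Degree w w≢0
  ...   | e , w=e = ⊥-elim (proj₂ (Degree-*P {f = D} {g = w} D=d w=e) (trans (coeff-≡ Dw≋x (d +ℕ e)) (x<d _ (ℕ.m≤m+n d e))))

  *P-0∷ : ∀ D g → D *P (0# ∷ g) ≋ 0# ∷ (D *P g)
  *P-0∷ D g = ≋-trans (*P-∷ʳ D 0# g) (+P-cong {f = scale 0# D} {f′ = []} (mk≋ λ n → trans (coeff-scale 0# D n) (K.zeroˡ _)) ≋-refl)

  *P-constant : ∀ D c → D *P (c ∷ []) ≋ scale c D
  *P-constant D c = ≋-trans (*P-∷ʳ D c [])
    (≋-trans (+P-cong ≋-refl (∷-cong refl (*P-zeroʳ D)))
      (≋-trans (+P-cong {f = scale c D} ≋-refl (mk≋ (coeff-0∷-zero [] ≋-refl))) (+P-identityʳ (scale c D))))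

  +P-transfer : ∀ x y z → x +P z ≋ (x +P y) +P (z -P y)
  +P-transfer x y z = begin
    x +P z                           ≈⟨ R.+-identityʳ (x +P z) ⟨
    (x +P z) +P []                   ≈⟨ +P-cong ≋-refl (-P-inverseʳ y) ⟨
    (x +P z) +P (y +P (-P y))        ≈⟨ R-Solver.solve 4 (λ x y z y⁻ → ((x ⊕ z) ⊕ (y ⊕ y⁻)) ⊜ ((x ⊕ y) ⊕ (z ⊕ y⁻))) ≋-refl x y z (-P y) ⟩
    (x +P y) +P (z -P y)             ∎
    where
    open SetoidReasoning R.setoid
    open R-Solver using (_⊕_; _⊜_)

  record Division (d : ℕ) (D f : Poly q) : Set where
    constructor division
    field
      quotient remainder : Poly q
      quotient-remainder : f ≋ (D *P quotient) +P remainder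
      remainder-degree   : DegreeBelow d remainder

  divide : ∀ {d} D → Degree d D → ∀ f → Division d D f
  divide {d} D D=d [] = division [] [] (≋-sym (≋-trans (+P-identityʳ _) (*P-zeroʳ D))) (λ _ _ → refl)
  divide {d} D D=d@(D≤d , lc≢0) (a ∷ f) =
    division (Q′ ∷ᶜ c) (R₁ -P scale c D) (≋-trans shift-in (≋-trans subtract-cD add-cD)) remainder-lowers
    where
    open Division (divide D D=d f) renaming (quotient to Q′; remainder to R′; quotient-remainder to f≋; remainder-degree to R′<d)
    lc⁻¹ : Fin q
    lc⁻¹ = proj₁ (EnumField.inverse F (coeff D d) lc≢0)
    R₁ : Poly q
    R₁ = a ∷ R′
    c : Fin q
    c = coeff R₁ d * lc⁻¹
    _∷ᶜ_ : Poly q → Fin q → Poly q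
    g ∷ᶜ c = (0# ∷ g) +P (c ∷ [])
    shift-in : a ∷ f ≋ (D *P (0# ∷ Q′)) +P R₁
    shift-in = ≋-trans (∷-cong (sym (K.+-identityˡ a)) f≋) (+P-cong (≋-sym (*P-0∷ D Q′)) ≋-refl)
    subtract-cD : (D *P (0# ∷ Q′)) +P R₁ ≋ ((D *P (0# ∷ Q′)) +P scale c D) +P (R₁ -P scale c D)
    subtract-cD = +P-transfer (D *P (0# ∷ Q′)) (scale c D) R₁
    add-cD : ((D *P (0# ∷ Q′)) +P scale c D) +P (R₁ -P scale c D) ≋ (D *P (Q′ ∷ᶜ c)) +P (R₁ -P scale c D)
    add-cD = +P-cong (≋-trans (+P-cong ≋-refl (≋-sym (*P-constant D c))) (≋-sym (R.distribˡ D (0# ∷ Q′) (c ∷ [])))) ≋-refl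
    R₁≤d : DegreeBelow (suc d) R₁
    R₁≤d zero    ()
    R₁≤d (suc k) (s≤s d≤k) = R′<d k d≤k
    leading-cancels : coeff R₁ d + - (c * coeff D d) ≡ 0#
    leading-cancels = begin
      coeff R₁ d + - (c * coeff D d)                         ≡⟨ cong (λ x → coeff R₁ d + - x) (K.*-assoc _ lc⁻¹ _) ⟩
      coeff R₁ d + - (coeff R₁ d * (lc⁻¹ * coeff D d))       ≡⟨ cong (λ x → coeff R₁ d + - (coeff R₁ d * x)) lc⁻¹lc≡1 ⟩
      coeff R₁ d + - (coeff R₁ d * 1#)                       ≡⟨ cong (λ x → coeff R₁ d + - x) (K.*-identityʳ _) ⟩
      coeff R₁ d + - coeff R₁ d                              ≡⟨ K.-‿inverseʳ _ ⟩
      0#                                                     ∎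
      where
      open ≡-Reasoning
      lc⁻¹lc≡1 : lc⁻¹ * coeff D d ≡ 1#
      lc⁻¹lc≡1 = trans (K.*-comm lc⁻¹ _) (proj₂ (EnumField.inverse F (coeff D d) lc≢0))
    remainder-lowers : DegreeBelow d (R₁ -P scale c D)
    remainder-lowers k d≤k with ℕ.m≤n⇒m<n∨m≡n d≤k
    ... | inj₁ d<k  = DegreeBelow-+P R₁ (-P scale c D) R₁≤d (DegreeBelow--P (scale c D) cD≤d) k d<k
      where
      cD≤d : DegreeBelow (suc d) (scale c D)
      cD≤d k d<k = trans (coeff-scale c D k) (trans (cong (c *_) (D≤d k d<k)) (K.zeroʳ c))
    ... | inj₂ refl = trans (coeff-+P R₁ (-P scale c D) d)
                        (trans (cong (coeff R₁ d +_) (trans (coeff--P (scale c D) d) (cong -_ (coeff-scale c D d)))) leading-cancels)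

  +P-moveˡ : ∀ f x r → f ≋ x +P r → r ≋ f -P x
  +P-moveˡ f x r f≋x+r = ≋-trans (≋-sym (xyx⁻¹≈y x r)) (+P-cong (≋-sym f≋x+r) ≋-refl)

  -P-zero⇒≋ : ∀ x y → [] ≋ x -P y → x ≋ y
  -P-zero⇒≋ x y x-y≋0 = x∙y⁻¹≈ε⇒x≈y x y (≋-sym x-y≋0)

  infix 4 _∣_
  record _∣_ (A x : Poly q) : Set where
    constructor divides
    field
      cofactor    : Poly q
      cofactor-eq : A *P cofactor ≋ x

  ∣⇒∣P : ∀ {A x} → A ∣ x → A ∣P x
  ∣⇒∣P (divides h Ah≋x) = h , ≋⇒≈P Ah≋x

  ∣P⇒∣ : ∀ {A x} → A ∣P x → A ∣ x
  ∣P⇒∣ (h , Ah≈x) = divides h (≈P⇒≋ Ah≈x)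

  ∣-respʳ : ∀ {A x y} → x ≋ y → A ∣ x → A ∣ y
  ∣-respʳ x≋y (divides h Ah≋x) = divides h (≋-trans Ah≋x x≋y)

  ∣-refl : ∀ A → A ∣ A
  ∣-refl A = divides oneP (R.*-identityʳ A)

  ∣-trans : ∀ {A B x} → A ∣ B → B ∣ x → A ∣ x
  ∣-trans {A} (divides h Ah≋B) (divides k Bk≋x) =
    divides (h *P k) (≋-trans (≋-sym (*P-assoc A h k)) (≋-trans (*P-congʳ k Ah≋B) Bk≋x))

  oneP-∣ : ∀ x → oneP ∣ x
  oneP-∣ x = divides x (*P-identityˡ x)

  ∣-*Pʳ : ∀ {A x} y → A ∣ x → A ∣ x *P y
  ∣-*Pʳ {A} y (divides h Ah≋x) = divides (h *P y) (≋-trans (≋-sym (*P-assoc A h y)) (*P-congʳ y Ah≋x))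

  ∣-*Pˡ : ∀ {A x} y → A ∣ x → A ∣ y *P x
  ∣-*Pˡ {x = x} y A∣x = ∣-respʳ (*P-comm x y) (∣-*Pʳ y A∣x)

  *P-∣-*P : ∀ {A B x y} → A ∣ x → B ∣ y → A *P B ∣ x *P y
  *P-∣-*P {A} {B} (divides h Ah≋x) (divides k Bk≋y) = divides (h *P k)
    (≋-trans (R-Solver.solve 4 (λ A B h k → ((A ⊗ B) ⊗ (h ⊗ k)) ⊜ ((A ⊗ h) ⊗ (B ⊗ k))) ≋-refl A B h k) (*P-cong Ah≋x Bk≋y))
    where open R-Solver using (_⊗_; _⊜_)

  ∣-+P-cancelˡ : ∀ {A} x y → A ∣ x → A ∣ x +P y → A ∣ y
  ∣-+P-cancelˡ {A} x y (divides h Ah≋x) (divides k Ak≋x+y) = divides (k -P h)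
    (≋-trans (x[y-z]≈xy-xz A k h) (≋-trans (+P-cong Ak≋x+y (-P-cong Ah≋x)) (≋-sym (+P-moveˡ (x +P y) x y ≋-refl))))

  *P-cancelˡ : ∀ {d} D {w w′} → Degree d D → D *P w ≋ D *P w′ → w ≋ w′
  *P-cancelˡ {d} D {w} {w′} D=d Dw≋Dw′ = -P-zero⇒≋ w w′
    (multiple-of-lower-degree⇒zero D {w = w -P w′} {x = []} D=d
      (≋-trans (x[y-z]≈xy-xz D w w′) (≋-trans (+P-cong Dw≋Dw′ ≋-refl) (-P-inverseʳ (D *P w′)))) (λ _ _ → refl))

  nonzero-of-lower-degree-∤ : ∀ {d D x} → Degree d D → DegreeBelow d x → ¬ [] ≋ x → ¬ D ∣ x
  nonzero-of-lower-degree-∤ {D = D} D=d x<d x≢0 (divides h Dh≋x) =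
    x≢0 (≋-trans (≋-sym (≋-trans (*P-congˡ D (≋-sym (multiple-of-lower-degree⇒zero D D=d Dh≋x x<d))) (*P-zeroʳ D))) Dh≋x)

  ∣-+P : ∀ {A x y} → A ∣ x → A ∣ y → A ∣ x +P y
  ∣-+P {A} (divides h Ah≋x) (divides k Ak≋y) = divides (h +P k) (≋-trans (R.distribˡ A h k) (+P-cong Ah≋x Ak≋y))

  ∣-zero : ∀ A → A ∣ []
  ∣-zero A = divides [] (*P-zeroʳ A)

  DegreeBelow-1-constant : ∀ u → DegreeBelow 1 u → u ≋ coeff u 0 ∷ []
  DegreeBelow-1-constant u u<1 = mk≋ λ { zero → refl ; (suc k) → u<1 (suc k) (s≤s z≤n) }

  nonzero-constant-invertible : ∀ u → DegreeBelow 1 u → ¬ [] ≋ u → Σ (Poly q) λ v → u *P v ≋ oneP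
  nonzero-constant-invertible u u<1 u≢0 =
    c⁻¹ ∷ [] ,
    ≋-trans (*P-congʳ (c⁻¹ ∷ []) (DegreeBelow-1-constant u u<1))
      (≋-trans (*P-constant (coeff u 0 ∷ []) c⁻¹) (∷-cong (trans (K.*-comm c⁻¹ _) cc⁻¹≡1) ≋-refl))
    where
    u₀≢0 : ¬ coeff u 0 ≡ 0#
    u₀≢0 u₀≡0 = u≢0 (≋-trans (mk≋ λ { zero → sym u₀≡0 ; (suc n) → refl }) (≋-sym (DegreeBelow-1-constant u u<1)))
    c⁻¹ : Fin q
    c⁻¹ = proj₁ (EnumField.inverse F (coeff u 0) u₀≢0)
    cc⁻¹≡1 : coeff u 0 * c⁻¹ ≡ 1#
    cc⁻¹≡1 = proj₂ (EnumField.inverse F (coeff u 0) u₀≢0)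

  -- The order δ and base-q digits

  1<q : 1 < q
  1<q = subst (_< q) (EnumField.one-idx F) (toℕ<n 1#)

  toℕ≡0⇒≡0# : ∀ {c} → toℕ c ≡ 0 → c ≡ 0#
  toℕ≡0⇒≡0# toℕc≡0 = toℕ-injective (trans toℕc≡0 (sym (EnumField.zero-idx F)))

  base-q-unique : ∀ a b x y → a < q → b < q → a +ℕ q *ℕ x ≡ b +ℕ q *ℕ y → a ≡ b × x ≡ y
  base-q-unique a b x y a<q b<q eq = a≡b , ℕ.*-cancelˡ-≡ x y q (ℕ.+-cancelˡ-≡ a _ _ (trans eq (cong (_+ℕ q *ℕ y) (sym a≡b))))
    where
    low-digit : ∀ c z → c < q → (c +ℕ q *ℕ z) % q ≡ c
    low-digit c z c<q = trans (cong (λ w → (c +ℕ w) % q) (ℕ.*-comm q z)) (trans ([m+kn]%n≡m%n c z q) (m<n⇒m%n≡m c<q))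
    a≡b : a ≡ b
    a≡b = trans (sym (low-digit a x a<q)) (trans (cong (_% q) eq) (low-digit b y b<q))

  δ-zero : ∀ g → [] ≋ g → δ g ≡ 0
  δ-zero []      g≋0 = refl
  δ-zero (b ∷ g) g≋0 = cong₂ _+ℕ_ (trans (cong toℕ (sym (coeff-≡ g≋0 0))) (EnumField.zero-idx F))
                                   (trans (cong (q *ℕ_) (δ-zero g (mk≋ λ n → coeff-≡ g≋0 (suc n)))) (ℕ.*-zeroʳ q))

  δ-cong : ∀ {f g} → f ≋ g → δ f ≡ δ g
  δ-cong {[]}    {g}     f≋g = sym (δ-zero g f≋g)
  δ-cong {a ∷ f} {[]}    f≋g = δ-zero (a ∷ f) (≋-sym f≋g)
  δ-cong {a ∷ f} {b ∷ g} f≋g = cong₂ _+ℕ_ (cong toℕ (coeff-≡ f≋g 0)) (cong (q *ℕ_) (δ-cong (tail-≋ f≋g)))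

  δ≡0⇒zero : ∀ g → δ g ≡ 0 → [] ≋ g
  δ≡0⇒zero []      _    = ≋-refl
  δ≡0⇒zero (b ∷ g) δ≡0 = mk≋ λ
    { zero    → sym (toℕ≡0⇒≡0# (ℕ.m+n≡0⇒m≡0 (toℕ b) δ≡0))
    ; (suc n) → coeff-≡ (δ≡0⇒zero g (ℕ.m*n≡0⇒m≡0 (δ g) q (trans (ℕ.*-comm (δ g) q) (ℕ.m+n≡0⇒n≡0 (toℕ b) δ≡0)))) n }

  δ-injective : ∀ f g → δ f ≡ δ g → f ≋ g
  δ-injective []      g       eq = δ≡0⇒zero g (sym eq)
  δ-injective (a ∷ f) []      eq = ≋-sym (δ≡0⇒zero (a ∷ f) eq)
  δ-injective (a ∷ f) (b ∷ g) eq with base-q-unique (toℕ a) (toℕ b) (δ f) (δ g) (toℕ<n a) (toℕ<n b) eq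
  ... | a≡b , δf≡δg = ∷-cong (toℕ-injective a≡b) (δ-injective f g δf≡δg)

  δ-digitsFuel : ∀ k n → n ≤ k → δ (digitsFuel k n) ≡ n
  δ-digitsFuel zero    zero    _         = refl
  δ-digitsFuel (suc k) zero    _         = refl
  δ-digitsFuel (suc k) (suc n) (s≤s n≤k) = begin
    toℕ (fromℕ< (m%n<n (suc n) q)) +ℕ q *ℕ δ (digitsFuel k (suc n / q)) ≡⟨ cong₂ _+ℕ_ (toℕ-fromℕ< _) (cong (q *ℕ_) (δ-digitsFuel k (suc n / q) n/q≤k)) ⟩
    suc n % q +ℕ q *ℕ (suc n / q)                                          ≡⟨ cong (suc n % q +ℕ_) (ℕ.*-comm q (suc n / q)) ⟩
    suc n % q +ℕ (suc n / q) *ℕ q                                          ≡⟨ m≡m%n+[m/n]*n (suc n) q ⟨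
    suc n                                                                  ∎
    where
    open ≡-Reasoning
    n/q≤k : suc n / q ≤ k
    n/q≤k = ℕ.≤-trans (ℕ.≤-pred (m/n<m (suc n) q 1<q)) n≤k

  δ-digits : ∀ n → δ (digits n) ≡ n
  δ-digits n = δ-digitsFuel n n ℕ.≤-refl

  digits-δ : ∀ f → digits (δ f) ≋ f
  digits-δ f = δ-injective _ f (δ-digits (δ f))

  DegreeBelow⇒δ< : ∀ n f → DegreeBelow n f → δ f < q ^ n
  DegreeBelow⇒δ< zero    f       f<0 = subst (_< 1) (sym (δ-zero f (DegreeBelow-zero f f<0))) (s≤s z≤n)
  DegreeBelow⇒δ< (suc n) []      _   = ℕ.m^n>0 q (suc n)
  DegreeBelow⇒δ< (suc n) (a ∷ f) f≤n = begin
    suc (toℕ a +ℕ q *ℕ δ f) ≤⟨ ℕ.+-monoˡ-≤ (q *ℕ δ f) (toℕ<n a) ⟩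
    q +ℕ q *ℕ δ f           ≡⟨ ℕ.*-suc q (δ f) ⟨
    q *ℕ suc (δ f)          ≤⟨ ℕ.*-monoʳ-≤ q (DegreeBelow⇒δ< n f (DegreeBelow-∷ f≤n)) ⟩
    q *ℕ q ^ n              ∎
    where open ℕ.≤-Reasoning

  δ<⇒DegreeBelow : ∀ n f → δ f < q ^ n → DegreeBelow n f
  δ<⇒DegreeBelow zero    f       δf<1 = zero-DegreeBelow f (δ≡0⇒zero f (ℕ.n<1⇒n≡0 δf<1))
  δ<⇒DegreeBelow (suc n) []      _    _       _         = refl
  δ<⇒DegreeBelow (suc n) (a ∷ f) δf<  (suc k) (s≤s n≤k) =
    δ<⇒DegreeBelow n f (ℕ.*-cancelˡ-< q (δ f) (q ^ n) (ℕ.≤-<-trans (ℕ.m≤n+m (q *ℕ δ f) (toℕ a)) δf<)) k n≤k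

  digits-DegreeBelow : ∀ n r → r < q ^ n → DegreeBelow n (digits r)
  digits-DegreeBelow n r r<qⁿ = δ<⇒DegreeBelow n (digits r) (subst (_< q ^ n) (sym (δ-digits r)) r<qⁿ)

  shift : ℕ → Poly q → Poly q
  shift d A = replicate d 0# ++ A

  δ-shift : ∀ d A → δ (shift d A) ≡ q ^ d *ℕ δ A
  δ-shift zero    A = sym (ℕ.*-identityˡ (δ A))
  δ-shift (suc d) A = begin
    toℕ 0# +ℕ q *ℕ δ (shift d A)  ≡⟨ cong₂ _+ℕ_ (EnumField.zero-idx F) (cong (q *ℕ_) (δ-shift d A)) ⟩
    q *ℕ (q ^ d *ℕ δ A)           ≡⟨ ℕ.*-assoc q (q ^ d) (δ A) ⟨
    q *ℕ q ^ d *ℕ δ A             ∎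
    where open ≡-Reasoning

  δ-shift-digits : ∀ d e → δ (shift d (digits e)) ≡ q ^ d *ℕ e
  δ-shift-digits d e = trans (δ-shift d (digits e)) (cong (q ^ d *ℕ_) (δ-digits e))

  δ-shift-+P : ∀ d A r → DegreeBelow d r → δ (shift d A +P r) ≡ q ^ d *ℕ δ A +ℕ δ r
  δ-shift-+P zero    A r       r<0 = begin
    δ (A +P r)          ≡⟨ δ-cong (≋-trans (+P-cong ≋-refl (≋-sym (DegreeBelow-zero r r<0))) (+P-identityʳ A)) ⟩
    δ A                 ≡⟨ ℕ.+-identityʳ (δ A) ⟨
    δ A +ℕ 0            ≡⟨ cong₂ _+ℕ_ (ℕ.*-identityˡ (δ A)) (δ-zero r (DegreeBelow-zero r r<0)) ⟨
    1 *ℕ δ A +ℕ δ r     ∎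
    where open ≡-Reasoning
  δ-shift-+P (suc d) A []      _   = trans (δ-shift (suc d) A) (sym (ℕ.+-identityʳ _))
  δ-shift-+P (suc d) A (c ∷ r) r≤d = begin
    toℕ (0# + c) +ℕ q *ℕ δ (shift d A +P r)  ≡⟨ cong₂ _+ℕ_ (cong toℕ (K.+-identityˡ c)) (cong (q *ℕ_) (δ-shift-+P d A r (DegreeBelow-∷ r≤d))) ⟩
    toℕ c +ℕ q *ℕ (q ^ d *ℕ δ A +ℕ δ r)      ≡⟨ regroup (toℕ c) q (q ^ d) (δ A) (δ r) ⟩
    q *ℕ q ^ d *ℕ δ A +ℕ (toℕ c +ℕ q *ℕ δ r) ∎
    where
    open ≡-Reasoning
    open +-*-Solver
    regroup : ∀ c q Q x y → c +ℕ q *ℕ (Q *ℕ x +ℕ y) ≡ q *ℕ Q *ℕ x +ℕ (c +ℕ q *ℕ y)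
    regroup = solve 5 (λ c q Q x y → c :+ q :* (Q :* x :+ y) := q :* Q :* x :+ (c :+ q :* y)) refl

  digits-split : ∀ d j r → r < q ^ d → digits (q ^ d *ℕ j +ℕ r) ≋ shift d (digits j) +P digits r
  digits-split d j r r<Q = δ-injective _ _ (begin
    δ (digits (q ^ d *ℕ j +ℕ r))                    ≡⟨ δ-digits _ ⟩
    q ^ d *ℕ j +ℕ r                                 ≡⟨ cong₂ (λ a b → q ^ d *ℕ a +ℕ b) (δ-digits j) (δ-digits r) ⟨
    q ^ d *ℕ δ (digits j) +ℕ δ (digits r)           ≡⟨ δ-shift-+P d (digits j) (digits r) (digits-DegreeBelow d r r<Q) ⟨
    δ (shift d (digits j) +P digits r)              ∎)
    where open ≡-Reasoning

  -- Products and factorials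

  ∏ : ℕ → (ℕ → Poly q) → Poly q
  ∏ n u = foldr _*P_ oneP (applyUpTo u n)

  !-≡-∏ : ∀ f → f ! ≡ ∏ (δ f) (λ k → f -P digits k)
  !-≡-∏ f = cong (foldr _*P_ oneP) (map-applyUpTo (λ n → f -P digits n) (λ n → n) (δ f))

  ∏-cong : ∀ n {u v} → (∀ k → k < n → u k ≋ v k) → ∏ n u ≋ ∏ n v
  ∏-cong zero    u≋v = ≋-refl
  ∏-cong (suc n) u≋v = *P-cong (u≋v 0 (s≤s z≤n)) (∏-cong n (λ k k<n → u≋v (suc k) (s≤s k<n)))

  ∏-+ : ∀ m n u → ∏ (m +ℕ n) u ≋ ∏ m u *P ∏ n (λ k → u (m +ℕ k))
  ∏-+ zero    n u = ≋-sym (*P-identityˡ _)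
  ∏-+ (suc m) n u = ≋-trans (*P-congˡ (u 0) (∏-+ m n (λ k → u (suc k)))) (≋-sym (*P-assoc (u 0) _ _))

  ∏-blocks : ∀ b m u → ∏ (b *ℕ m) u ≋ ∏ m (λ j → ∏ b (λ r → u (b *ℕ j +ℕ r)))
  ∏-blocks b zero    u = ≋-reflexive (cong (λ n → ∏ n u) (ℕ.*-zeroʳ b))
  ∏-blocks b (suc m) u = begin
    ∏ (b *ℕ suc m) u
      ≡⟨ cong (λ n → ∏ n u) (ℕ.*-suc b m) ⟩
    ∏ (b +ℕ b *ℕ m) u
      ≈⟨ ∏-+ b (b *ℕ m) u ⟩
    ∏ b u *P ∏ (b *ℕ m) (λ k → u (b +ℕ k))
      ≈⟨ *P-cong first-block (∏-blocks b m (λ k → u (b +ℕ k))) ⟩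
    ∏ b (λ r → u (b *ℕ 0 +ℕ r)) *P ∏ m (λ j → ∏ b (λ r → u (b +ℕ (b *ℕ j +ℕ r))))
      ≈⟨ *P-congˡ (∏ b (λ r → u (b *ℕ 0 +ℕ r))) (∏-cong m λ j _ → ∏-cong b λ r _ → ≋-reflexive (cong u (later-block j r))) ⟩
    ∏ (suc m) (λ j → ∏ b (λ r → u (b *ℕ j +ℕ r)))
      ∎
    where
    open SetoidReasoning R.setoid
    first-block : ∏ b u ≋ ∏ b (λ r → u (b *ℕ 0 +ℕ r))
    first-block = ∏-cong b λ r _ → ≋-reflexive (cong (λ n → u (n +ℕ r)) (sym (ℕ.*-zeroʳ b)))
    later-block : ∀ j r → b +ℕ (b *ℕ j +ℕ r) ≡ b *ℕ suc j +ℕ r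
    later-block j r = trans (sym (ℕ.+-assoc b (b *ℕ j) r)) (cong (_+ℕ r) (sym (ℕ.*-suc b j)))

  ∣-∏ : ∀ {A} n u k → k < n → A ∣ u k → A ∣ ∏ n u
  ∣-∏ (suc n) u zero    _         A∣u₀ = ∣-*Pʳ (∏ n (λ k → u (suc k))) A∣u₀
  ∣-∏ (suc n) u (suc k) (s≤s k<n) A∣uₖ = ∣-*Pˡ (u 0) (∣-∏ n (λ k → u (suc k)) k k<n A∣uₖ)

  ^P-∣-∏ : ∀ {A} m u → (∀ j → j < m → A ∣ u j) → (A ^P m) ∣ ∏ m u
  ^P-∣-∏ zero    u A∣u = oneP-∣ _
  ^P-∣-∏ (suc m) u A∣u = *P-∣-*P (A∣u 0 (s≤s z≤n)) (^P-∣-∏ m (λ j → u (suc j)) (λ j j<m → A∣u (suc j) (s≤s j<m)))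

  ^P-+ : ∀ A k l → A ^P (k +ℕ l) ≋ (A ^P k) *P (A ^P l)
  ^P-+ A zero    l = ≋-sym (*P-identityˡ _)
  ^P-+ A (suc k) l = ≋-trans (*P-congˡ A (^P-+ A k l)) (≋-sym (*P-assoc A (A ^P k) (A ^P l)))

  -- Irreducible polynomials are prime

  Irreducible⇒1≤degree : ∀ {d} P → Degree d P → Irreducible P → 1 ≤ d
  Irreducible⇒1≤degree {zero}  P (P<1 , _) (nonconstant , _) = ⊥-elim (nonconstant (DegreeBelow⇒length-norm≤ P P<1))
  Irreducible⇒1≤degree {suc d} _ _ _ = s≤s z≤n

  Irreducible⇒constant-factor : ∀ P → Irreducible P → ∀ a b → a *P b ≋ P → DegreeBelow 1 a ⊎ DegreeBelow 1 b
  Irreducible⇒constant-factor P (_ , constant-factor) a b ab≋P with constant-factor a b (≋⇒≈P ab≋P)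
  ... | inj₁ a-constant = inj₁ (length-norm≤⇒DegreeBelow a a-constant)
  ... | inj₂ b-constant = inj₂ (length-norm≤⇒DegreeBelow b b-constant)

  module IrreduciblePolynomial (P : Poly q) {d : ℕ} (P=d : Degree d P) (nonconstant : 1 ≤ d)
    (irreducible : ∀ a b → a *P b ≋ P → DegreeBelow 1 a ⊎ DegreeBelow 1 b) where

    record InIdeal (a u : Poly q) : Set where
      constructor combination
      field
        x y : Poly q
        combination-eq : u ≋ (x *P a) +P (y *P P)

    module _ {a : Poly q} where

      InIdeal-resp : ∀ {u v} → u ≋ v → InIdeal a u → InIdeal a v
      InIdeal-resp u≋v (combination x y u≋) = combination x y (≋-trans (≋-sym u≋v) u≋)

      generator-InIdeal : InIdeal a a
      generator-InIdeal = combination oneP [] (≋-sym (≋-trans (+P-identityʳ _) (*P-identityˡ a)))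

      P-InIdeal : InIdeal a P
      P-InIdeal = combination [] oneP (≋-sym (*P-identityˡ P))

      InIdeal-+P : ∀ {u v} → InIdeal a u → InIdeal a v → InIdeal a (u +P v)
      InIdeal-+P (combination x y u≋) (combination x′ y′ v≋) = combination (x +P x′) (y +P y′)
        (≋-trans (+P-cong u≋ v≋)
          (R-Solver.solve 6 (λ x y x′ y′ a P → (((x ⊗ a) ⊕ (y ⊗ P)) ⊕ ((x′ ⊗ a) ⊕ (y′ ⊗ P))) ⊜ (((x ⊕ x′) ⊗ a) ⊕ ((y ⊕ y′) ⊗ P)))
                             ≋-refl x y x′ y′ a P))
        where open R-Solver using (_⊕_; _⊗_; _⊜_)

      InIdeal--P : ∀ {u} → InIdeal a u → InIdeal a (-P u)
      InIdeal--P (combination x y u≋) = combination (-P x) (-P y)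
        (≋-trans (-P-cong u≋) (≋-trans (≋-sym (⁻¹-∙-comm (x *P a) (y *P P))) (+P-cong (-‿distribˡ-* x a) (-‿distribˡ-* y P))))

      InIdeal-*P : ∀ {u} z → InIdeal a u → InIdeal a (u *P z)
      InIdeal-*P z (combination x y u≋) = combination (x *P z) (y *P z)
        (≋-trans (*P-congʳ z u≋) (≋-trans (*P-distribʳ z (x *P a) (y *P P)) (+P-cong (*P-rotate x a z) (*P-rotate y P z))))

      data Reduction (k : ℕ) (u f : Poly q) : Set where
        exact   : u ∣ f → Reduction k u f
        smaller : ∀ {k′ r} → InIdeal a r → Degree k′ r → k′ < k → Reduction k u f

      reduce : ∀ {k u f} → InIdeal a u → InIdeal a f → Degree k u → Reduction k u f
      reduce {u = u} {f} u∈ f∈ u=k with divide u u=k f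
      ... | division Q r f≋uQ+r r<k with zero? r
      ...   | yes r≋0 = exact (divides Q (≋-sym (≋-trans f≋uQ+r (≋-trans (+P-cong ≋-refl (≋-sym r≋0)) (+P-identityʳ _)))))
      ...   | no r≢0 with nonzero⇒Degree r r≢0
      ...     | k′ , r=k′ = smaller (InIdeal-resp (≋-sym (+P-moveˡ f (u *P Q) r f≋uQ+r)) (InIdeal-+P f∈ (InIdeal--P (InIdeal-*P Q u∈))))
                              r=k′ (ℕ.≰⇒> (λ k≤k′ → proj₂ r=k′ (r<k k′ k≤k′)))

    P≢0 : ¬ [] ≋ P
    P≢0 = Degree⇒nonzero P=d

    factor-with-constant-cofactor-divides : ∀ u Q → u *P Q ≋ P → DegreeBelow 1 Q → P ∣ u
    factor-with-constant-cofactor-divides u Q uQ≋P Q<1 = divides v (begin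
      P *P v          ≈⟨ *P-congʳ v uQ≋P ⟨
      (u *P Q) *P v   ≈⟨ *P-assoc u Q v ⟩
      u *P (Q *P v)   ≈⟨ *P-congˡ u Qv≋1 ⟩
      u *P oneP       ≈⟨ R.*-identityʳ u ⟩
      u               ∎)
      where
      open SetoidReasoning R.setoid
      Q≢0 : ¬ [] ≋ Q
      Q≢0 Q≋0 = P≢0 (≋-trans (≋-sym (≋-trans (*P-congˡ u (≋-sym Q≋0)) (*P-zeroʳ u))) uQ≋P)
      v : Poly q
      v = proj₁ (nonzero-constant-invertible Q Q<1 Q≢0)
      Qv≋1 : Q *P v ≋ oneP
      Qv≋1 = proj₂ (nonzero-constant-invertible Q Q<1 Q≢0)

    -- Euclid's algorithm inside the ideal (a, P): remainders stay in the ideal and drop in degree,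
    -- and once u divides P, irreducibility makes u either a unit or an associate of P.
    Bézout-or-divides : ∀ n {a k u} → InIdeal a u → Degree k u → k < n → InIdeal a oneP ⊎ P ∣ a
    Bézout-or-divides (suc n) {u = u} u∈ u=k (s≤s k≤n) with reduce u∈ P-InIdeal u=k
    ... | smaller r∈ r=k′ k′<k = Bézout-or-divides n r∈ r=k′ (ℕ.<-≤-trans k′<k k≤n)
    ... | exact (divides Q uQ≋P) with irreducible u Q uQ≋P
    ...   | inj₁ u<1 = inj₁ (InIdeal-resp (proj₂ unit) (InIdeal-*P (proj₁ unit) u∈))
      where
      unit : Σ (Poly q) λ v → u *P v ≋ oneP
      unit = nonzero-constant-invertible u u<1 (Degree⇒nonzero u=k)
    ...   | inj₂ Q<1 with reduce u∈ generator-InIdeal u=k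
    ...     | smaller r∈ r=k′ k′<k = Bézout-or-divides n r∈ r=k′ (ℕ.<-≤-trans k′<k k≤n)
    ...     | exact u∣a = inj₂ (∣-trans (factor-with-constant-cofactor-divides u Q uQ≋P Q<1) u∣a)

    ∤⇒Bézout : ∀ a → ¬ P ∣ a → InIdeal a oneP
    ∤⇒Bézout a P∤a with zero? a
    ... | yes a≋0 = ⊥-elim (P∤a (∣-respʳ a≋0 (∣-zero P)))
    ... | no a≢0 with nonzero⇒Degree a a≢0
    ...   | k , a=k with Bézout-or-divides (suc k) generator-InIdeal a=k ℕ.≤-refl
    ...     | inj₁ 1∈ = 1∈
    ...     | inj₂ P∣a = ⊥-elim (P∤a P∣a)

    prime : ∀ a b → P ∣ a *P b → ¬ P ∣ a → P ∣ b
    prime a b P∣ab P∤a with ∤⇒Bézout a P∤a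
    ... | combination x y 1≋xa+yP = ∣-respʳ (≋-trans b≋ (*P-identityˡ b))
                                      (∣-+P (∣-*Pˡ x P∣ab) (∣-*Pʳ (y *P b) (∣-refl P)))
      where
      b≋ : (x *P (a *P b)) +P (P *P (y *P b)) ≋ oneP *P b
      b≋ = ≋-sym (≋-trans (*P-congʳ b 1≋xa+yP) (≋-trans (*P-distribʳ b (x *P a) (y *P P))
             (+P-cong (*P-assoc x a b) (≋-trans (*P-congʳ b (*P-comm y P)) (*P-assoc P y b)))))

    -- Valuations of products of factors of f!

    record Valuation (k : ℕ) (X : Poly q) : Set where
      constructor valuation
      field
        cofactor           : Poly q
        factorisation      : X ≋ (P ^P k) *P cofactor
        cofactor-coprime   : ¬ P ∣ cofactor

    Valuation-resp : ∀ {k X Y} → X ≋ Y → Valuation k X → Valuation k Y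
    Valuation-resp X≋Y (valuation U X≋ P∤U) = valuation U (≋-trans (≋-sym X≋Y) X≋) P∤U

    ∤⇒Valuation-0 : ∀ {X} → ¬ P ∣ X → Valuation 0 X
    ∤⇒Valuation-0 {X} P∤X = valuation X (≋-sym (*P-identityˡ X)) P∤X

    P∤oneP : ¬ P ∣ oneP
    P∤oneP = nonzero-of-lower-degree-∤ P=d oneP<d (λ 1≋0 → EnumField.0≢1 F (coeff-≡ 1≋0 0))
      where
      oneP<d : DegreeBelow d oneP
      oneP<d zero    d≤0 = ⊥-elim (ℕ.<⇒≱ nonconstant d≤0)
      oneP<d (suc k) _   = refl

    Valuation-*P : ∀ {k l X Y} → Valuation k X → Valuation l Y → Valuation (k +ℕ l) (X *P Y)
    Valuation-*P {k} {l} {X} {Y} (valuation U X≋ P∤U) (valuation V Y≋ P∤V) =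
      valuation (U *P V) XY≋ (λ P∣UV → P∤V (prime U V P∣UV P∤U))
      where
      XY≋ : X *P Y ≋ (P ^P (k +ℕ l)) *P (U *P V)
      XY≋ = ≋-trans (*P-cong X≋ Y≋)
              (≋-trans (R-Solver.solve 4 (λ A B U V → ((A ⊗ U) ⊗ (B ⊗ V)) ⊜ ((A ⊗ B) ⊗ (U ⊗ V))) ≋-refl (P ^P k) (P ^P l) U V)
                (*P-congʳ (U *P V) (≋-sym (^P-+ P k l))))
        where open R-Solver using (_⊗_; _⊜_)

    Valuation⇒∤ : ∀ {k X} e → Valuation k X → k < e → ¬ (P ^P e) ∣ X
    Valuation⇒∤ {zero}  (suc e) (valuation U X≋ P∤U) _ (divides w Pᵉw≋X) =
      P∤U (divides ((P ^P e) *P w) (≋-trans (≋-sym (*P-assoc P (P ^P e) w)) (≋-trans Pᵉw≋X (≋-trans X≋ (*P-identityˡ U)))))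
    Valuation⇒∤ {suc k} (suc e) (valuation U X≋ P∤U) (s≤s k<e) (divides w Pᵉw≋X) =
      Valuation⇒∤ e (valuation U ≋-refl P∤U) k<e
        (divides w (*P-cancelˡ P P=d (≋-trans (≋-sym (*P-assoc P (P ^P e) w)) (≋-trans Pᵉw≋X (≋-trans X≋ (*P-assoc P (P ^P k) U))))))

    ValuationAtMost : ℕ → Poly q → Set
    ValuationAtMost k X = Σ ℕ λ c → c ≤ k × Valuation c X

    ValuationAtMost-*P : ∀ {k l X Y} → ValuationAtMost k X → ValuationAtMost l Y → ValuationAtMost (k +ℕ l) (X *P Y)
    ValuationAtMost-*P (c , c≤k , vX) (c′ , c′≤l , vY) = c +ℕ c′ , ℕ.+-mono-≤ c≤k c′≤l , Valuation-*P vX vY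

    ValuationAtMost⇒∤ : ∀ {k X} e → ValuationAtMost k X → k < e → ¬ (P ^P e) ∣ X
    ValuationAtMost⇒∤ e (c , c≤k , vX) k<e = Valuation⇒∤ e vX (ℕ.≤-<-trans c≤k k<e)

    DegreeBelow-2d⇒ValuationAtMost-1 : ∀ X → DegreeBelow (d +ℕ d) X → ¬ [] ≋ X → ValuationAtMost 1 X
    DegreeBelow-2d⇒ValuationAtMost-1 X X<2d X≢0 with divide P P=d X
    ... | division W r X≋PW+r r<d with zero? r
    ...   | no r≢0 = 0 , z≤n , ∤⇒Valuation-0 (λ P∣X →
                     nonzero-of-lower-degree-∤ P=d r<d r≢0 (∣-+P-cancelˡ (P *P W) r (divides W ≋-refl) (∣-respʳ X≋PW+r P∣X)))
    ...   | yes r≋0 = 1 , ℕ.≤-refl , valuation W (≋-trans X≋PW (*P-congʳ W (≋-sym (R.*-identityʳ P)))) P∤W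
      where
      X≋PW : X ≋ P *P W
      X≋PW = ≋-trans X≋PW+r (≋-trans (+P-cong ≋-refl (≋-sym r≋0)) (+P-identityʳ _))
      P∤W : ¬ P ∣ W
      P∤W (divides Z PZ≋W) = X≢0 (≋-sym (≋-trans X≋PW (≋-trans (*P-congˡ P (≋-sym PZ≋W))
        (≋-trans (≋-sym (*P-assoc P P Z)) (≋-trans (*P-congˡ (P *P P) (≋-sym Z≋0)) (*P-zeroʳ (P *P P)))))))
        where
        Z≋0 : [] ≋ Z
        Z≋0 = multiple-of-lower-degree⇒zero (P *P P) (Degree-*P {f = P} {g = P} P=d P=d)
                (≋-trans (*P-assoc P P Z) (≋-trans (*P-congˡ P PZ≋W) (≋-sym X≋PW))) X<2d

    ∤-∏ : ∀ n u → (∀ k → k < n → ¬ P ∣ u k) → ¬ P ∣ ∏ n u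
    ∤-∏ zero    u P∤u = P∤oneP
    ∤-∏ (suc n) u P∤u P∣∏ =
      ∤-∏ n (λ k → u (suc k)) (λ k k<n → P∤u (suc k) (s≤s k<n)) (prime (u 0) _ P∣∏ (P∤u 0 (s≤s z≤n)))

    ValuationAtMost-∏ : ∀ m u → (∀ j → j < m → ValuationAtMost 1 (u j)) → ValuationAtMost m (∏ m u)
    ValuationAtMost-∏ zero    u _   = 0 , z≤n , ∤⇒Valuation-0 P∤oneP
    ValuationAtMost-∏ (suc m) u v≤1 =
      ValuationAtMost-*P (v≤1 0 (s≤s z≤n)) (ValuationAtMost-∏ m (λ j → u (suc j)) (λ j j<m → v≤1 (suc j) (s≤s j<m)))

    ValuationAtMost-1-∏ : ∀ n u r → (∀ k → k < n → ¬ k ≡ r → ¬ P ∣ u k) → ValuationAtMost 1 (u r)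
                        → ValuationAtMost 1 (∏ n u)
    ValuationAtMost-1-∏ zero    u r       _   _   = 0 , z≤n , ∤⇒Valuation-0 P∤oneP
    ValuationAtMost-1-∏ (suc n) u zero    P∤u v≤1 =
      ValuationAtMost-*P v≤1 (0 , z≤n , ∤⇒Valuation-0 (∤-∏ n (λ k → u (suc k)) (λ k k<n → P∤u (suc k) (s≤s k<n) λ ())))
    ValuationAtMost-1-∏ (suc n) u (suc r) P∤u v≤1 =
      ValuationAtMost-*P {k = 0} (0 , z≤n , ∤⇒Valuation-0 (P∤u 0 (s≤s z≤n) λ ()))
        (ValuationAtMost-1-∏ n (λ k → u (suc k)) r (λ k k<n k≢r → P∤u (suc k) (s≤s k<n) (k≢r ∘ ℕ.suc-injective)) v≤1)

    module Block (f : Poly q) (j : ℕ) where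

      factor : ℕ → Poly q
      factor r = f -P digits (q ^ d *ℕ j +ℕ r)

      open Division (divide P P=d (f -P shift d (digits j)))
        renaming (quotient to W; remainder to ρ; quotient-remainder to f-tʲ≋PW+ρ; remainder-degree to ρ<d)

      residue : ℕ
      residue = δ ρ

      residue<qᵈ : residue < q ^ d
      residue<qᵈ = DegreeBelow⇒δ< d ρ ρ<d

      factor-≋ : ∀ r → r < q ^ d → factor r ≋ (P *P W) +P (ρ -P digits r)
      factor-≋ r r<qᵈ = begin
        f -P digits (q ^ d *ℕ j +ℕ r)                   ≈⟨ +P-cong ≋-refl (-P-cong (digits-split d j r r<qᵈ)) ⟩
        f -P (shift d (digits j) +P digits r)           ≈⟨ +P-cong ≋-refl (≋-sym (⁻¹-∙-comm (shift d (digits j)) (digits r))) ⟩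
        f +P ((-P shift d (digits j)) +P (-P digits r)) ≈⟨ +P-assoc f _ _ ⟨
        (f -P shift d (digits j)) -P digits r           ≈⟨ +P-cong f-tʲ≋PW+ρ ≋-refl ⟩
        ((P *P W) +P ρ) -P digits r                     ≈⟨ +P-assoc (P *P W) ρ _ ⟩
        (P *P W) +P (ρ -P digits r)                     ∎
        where open SetoidReasoning R.setoid

      P∣factor-residue : P ∣ factor residue
      P∣factor-residue = divides W (≋-sym (≋-trans (factor-≋ residue residue<qᵈ)
        (≋-trans (+P-cong ≋-refl (≋-trans (+P-cong ≋-refl (-P-cong (digits-δ ρ))) (-P-inverseʳ ρ))) (+P-identityʳ _))))

      P∣factor⇒residue : ∀ r → r < q ^ d → P ∣ factor r → r ≡ residue
      P∣factor⇒residue r r<qᵈ P∣factor with zero? (ρ -P digits r)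
      ... | yes ρ-r≋0 = sym (trans (δ-cong (-P-zero⇒≋ ρ (digits r) ρ-r≋0)) (δ-digits r))
      ... | no ρ-r≢0 = ⊥-elim (nonzero-of-lower-degree-∤ P=d
              (DegreeBelow-+P ρ _ ρ<d (DegreeBelow--P (digits r) (digits-DegreeBelow d r r<qᵈ))) ρ-r≢0
              (∣-+P-cancelˡ (P *P W) _ (divides W ≋-refl) (∣-respʳ (factor-≋ r r<qᵈ) P∣factor)))

      P∣∏factor : P ∣ ∏ (q ^ d) factor
      P∣∏factor = ∣-∏ (q ^ d) factor residue residue<qᵈ P∣factor-residue

      ∏factor-ValuationAtMost-1 : ValuationAtMost 1 (factor residue) → ValuationAtMost 1 (∏ (q ^ d) factor)
      ∏factor-ValuationAtMost-1 = ValuationAtMost-1-∏ (q ^ d) factor residue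
        (λ r r<qᵈ r≢residue P∣factor → r≢residue (P∣factor⇒residue r r<qᵈ P∣factor))

    P^e∣!-shift-digits : ∀ e → (P ^P e) ∣ (shift d (digits e) !)
    P^e∣!-shift-digits e = ∣-respʳ (≋-sym T!≋) (^P-∣-∏ e _ (λ j _ → Block.P∣∏factor T j))
      where
      T : Poly q
      T = shift d (digits e)
      T!≋ : T ! ≋ ∏ e (λ j → ∏ (q ^ d) (Block.factor T j))
      T!≋ = ≋-trans (≋-reflexive (trans (!-≡-∏ T) (cong (λ n → ∏ n (λ k → T -P digits k)) (δ-shift-digits d e))))
                    (∏-blocks (q ^ d) e (λ k → T -P digits k))

    factor-ValuationAtMost-1 : ∀ h n → δ h < q ^ (d +ℕ d) → n < δ h → ValuationAtMost 1 (h -P digits n)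
    factor-ValuationAtMost-1 h n δh<q²ᵈ n<δh = DegreeBelow-2d⇒ValuationAtMost-1 (h -P digits n)
      (DegreeBelow-+P h (-P digits n) (δ<⇒DegreeBelow (d +ℕ d) h δh<q²ᵈ)
                      (DegreeBelow--P (digits n) (digits-DegreeBelow (d +ℕ d) n (ℕ.<-trans n<δh δh<q²ᵈ))))
      (λ h-n≋0 → ℕ.<-irrefl (sym (trans (δ-cong (-P-zero⇒≋ h (digits n) h-n≋0)) (δ-digits n))) n<δh)

    full-block-ValuationAtMost-1 : ∀ h j → δ h < q ^ (d +ℕ d) → q ^ d *ℕ suc j ≤ δ h
                                 → ValuationAtMost 1 (∏ (q ^ d) (Block.factor h j))
    full-block-ValuationAtMost-1 h j δh<q²ᵈ block≤δh =
      Block.∏factor-ValuationAtMost-1 h j (factor-ValuationAtMost-1 h _ δh<q²ᵈ (begin-strict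
        q ^ d *ℕ j +ℕ Block.residue h j <⟨ ℕ.+-monoʳ-< (q ^ d *ℕ j) (Block.residue<qᵈ h j) ⟩
        q ^ d *ℕ j +ℕ q ^ d             ≡⟨ trans (ℕ.+-comm (q ^ d *ℕ j) (q ^ d)) (sym (ℕ.*-suc (q ^ d) j)) ⟩
        q ^ d *ℕ suc j                  ≤⟨ block≤δh ⟩
        δ h                             ∎))
      where open ℕ.≤-Reasoning

    partial-block-∤ : ∀ h m r → r < q ^ d → δ h ≡ q ^ d *ℕ m +ℕ r → ¬ P ∣ ∏ r (Block.factor h m)
    partial-block-∤ h m r r<qᵈ δh≡ = ∤-∏ r (Block.factor h m) λ k k<r P∣factor →
      ℕ.<-irrefl (trans (Block.P∣factor⇒residue h m k (ℕ.<-trans k<r r<qᵈ) P∣factor) residue≡r) k<r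
      where
      factor-r≋0 : [] ≋ Block.factor h m r
      factor-r≋0 = ≋-sym (≋-trans (+P-cong ≋-refl (-P-cong (≋-trans (≋-reflexive (cong digits (sym δh≡))) (digits-δ h))))
                                  (-P-inverseʳ h))
      residue≡r : Block.residue h m ≡ r
      residue≡r = sym (Block.P∣factor⇒residue h m r r<qᵈ (∣-respʳ factor-r≋0 (∣-zero P)))

    !-ValuationAtMost : ∀ h m r → r < q ^ d → δ h ≡ q ^ d *ℕ m +ℕ r → δ h < q ^ (d +ℕ d) → ValuationAtMost m (h !)
    !-ValuationAtMost h m r r<qᵈ δh≡ δh<q²ᵈ =
      c , subst (c ≤_) (ℕ.+-identityʳ m) c≤m+0 , Valuation-resp (≋-sym h!≋) v
      where
      u : ℕ → Poly q
      u n = h -P digits n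
      h!≋ : h ! ≋ ∏ m (λ j → ∏ (q ^ d) (Block.factor h j)) *P ∏ r (Block.factor h m)
      h!≋ = ≋-trans (≋-reflexive (trans (!-≡-∏ h) (cong (λ n → ∏ n u) δh≡)))
              (≋-trans (∏-+ (q ^ d *ℕ m) r u) (*P-congʳ (∏ r (Block.factor h m)) (∏-blocks (q ^ d) m u)))
      full-block : ∀ j → j < m → q ^ d *ℕ suc j ≤ δ h
      full-block j j<m = ℕ.≤-trans (ℕ.*-monoʳ-≤ (q ^ d) j<m) (ℕ.≤-trans (ℕ.m≤m+n (q ^ d *ℕ m) r) (ℕ.≤-reflexive (sym δh≡)))
      bound : ValuationAtMost (m +ℕ 0) (∏ m (λ j → ∏ (q ^ d) (Block.factor h j)) *P ∏ r (Block.factor h m))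
      bound = ValuationAtMost-*P (ValuationAtMost-∏ m _ λ j j<m → full-block-ValuationAtMost-1 h j δh<q²ᵈ (full-block j j<m))
                                 (0 , z≤n , ∤⇒Valuation-0 (partial-block-∤ h m r r<qᵈ δh≡))
      c : ℕ
      c = proj₁ bound
      c≤m+0 : c ≤ m +ℕ 0
      c≤m+0 = proj₁ (proj₂ bound)
      v : Valuation c _
      v = proj₂ (proj₂ bound)

    P^e∤! : ∀ e h → e ≤ q ^ d → δ h < q ^ d *ℕ e → ¬ (P ^P e) ∣ (h !)
    P^e∤! e h e≤qᵈ δh<qᵈe = ValuationAtMost⇒∤ e (!-ValuationAtMost h m r r<qᵈ δh≡ δh<q²ᵈ) m<e
      where
      instance
        qᵈ≢0 : NonZero (q ^ d)
        qᵈ≢0 = ℕ.m^n≢0 q d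
      m r : ℕ
      m = δ h / q ^ d
      r = δ h % q ^ d
      r<qᵈ : r < q ^ d
      r<qᵈ = m%n<n (δ h) (q ^ d)
      m<e : m < e
      m<e = m<n*o⇒m/o<n (subst (δ h <_) (ℕ.*-comm (q ^ d) e) δh<qᵈe)
      δh≡ : δ h ≡ q ^ d *ℕ m +ℕ r
      δh≡ = trans (m≡m%n+[m/n]*n (δ h) (q ^ d)) (trans (ℕ.+-comm r (m *ℕ q ^ d)) (cong (_+ℕ r) (ℕ.*-comm m (q ^ d))))
      δh<q²ᵈ : δ h < q ^ (d +ℕ d)
      δh<q²ᵈ = ℕ.<-≤-trans δh<qᵈe (subst (q ^ d *ℕ e ≤_) (sym (ℕ.^-distribˡ-+-* q d d)) (ℕ.*-monoʳ-≤ (q ^ d) e≤qᵈ))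

corollary3p5 : (q : ℕ) {{_ : NonZero q}} (F : EnumField q)
    → (P : Poly q) (d : ℕ) → PolyOps.Irreducible F P → PolyOps.HasDegree F P d
    → (e : ℕ) → 1 ≤ e → e ≤ q ^ d
    → PolyOps.IsS F (PolyOps._^P_ F P e)
        (replicate d (EnumField.0# F) ++ PolyOps.digits F e)
corollary3p5 q F P d P-irreducible P-degree e _ e≤qᵈ =
  ∣⇒∣P (P^e∣!-shift-digits e) ,
  λ h δh<δT Pᵉ∣h! → P^e∤! e h e≤qᵈ (subst (δ h <_) (δ-shift-digits d e) δh<δT) (∣P⇒∣ Pᵉ∣h!)
  where
  open PolynomialsOver F
  open PolyOps F
  P=d : Degree d P
  P=d = HasDegree⇒Degree P d P-degree
  open IrreduciblePolynomial P P=d (Irreducible⇒1≤degree P P=d P-irreducible) (Irreducible⇒constant-factor P P-irreducible)
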